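{- Let $(W,S)$ be a simply-laced triangle-free Coxeter system. If ${\boldsymbol{\varphi}}$ is a Fibonacci link of rank $r$, then the braid graph $B({\boldsymbol{\varphi}})$ is isomorphic to the Fibonacci cube $\mathcal{F}_r$.
   Context: A Coxeter system $(W,S)$ consists of a finite set $S$ and a group $W$ with presentation $\langle S \mid (st)^{m(s,t)}=e\rangle$, $m(s,s)=1$, $m(s,t)\in\{2,3,\dots,\infty\}$ for $s\ne t$. Simply laced: $m(s,t)\le3$ for all $s,t$. Coxeter graph $\Gamma$: vertices $S$, edge $\{s,t\}$ iff $m(s,t)\ge3$; triangle free: $\Gamma$ has no three-cycles. Reduced expression: word in $S$ of minimal length representing a given element. Braid move: replace a consecutive subword $sts$ by $tst$ with $m(s,t)=3$. The braid class $[{\boldsymbol{\alpha}}]$ of a reduced expression ${\boldsymbol{\alpha}}$ is the set of reduced expressions reachable from ${\boldsymbol{\alpha}}$ by sequences of braid moves; the braid graph $B({\boldsymbol{\alpha}})$ has vertex set $[{\boldsymbol{\alpha}}]$ with edges between expressions differing by one braid move. For ${\boldsymbol{\alpha}}=s_{x_1}\cdots s_{x_m}$, the position interval $\llbracket i,i+2\rrbracket$ is a braid shadow of ${\boldsymbol{\alpha}}$ if $s_{x_i}=s_{x_{i+2}}$ and $m(s_{x_i},s_{x_{i+1}})=3$; $\operatorname{bs}({\boldsymbol{\alpha}})$ denotes the set of braid shadows, $\operatorname{bs}([{\boldsymbol{\alpha}}])=\bigcup_{{\boldsymbol{\beta}}\in[{\boldsymbol{\alpha}}]}\operatorname{bs}({\boldsymbol{\beta}})$,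 and $\operatorname{rank}({\boldsymbol{\alpha}})=|\operatorname{bs}([{\boldsymbol{\alpha}}])|$. A reduced expression ${\boldsymbol{\alpha}}$ with $m\ge1$ letters is a link if $m=1$, or $m$ is odd and $\operatorname{bs}([{\boldsymbol{\alpha}}])=\{\llbracket1,3\rrbracket,\llbracket3,5\rrbracket,\dots,\llbracket m-2,m\rrbracket\}$ (so a link of rank $r$ has $2r+1$ letters). A Fibonacci link is a link ${\boldsymbol{\varphi}}$ with $\operatorname{bs}([{\boldsymbol{\varphi}}])=\operatorname{bs}({\boldsymbol{\varphi}})$. The hypercube $Q_r$ has vertices $\{0,1\}^r$, adjacent iff differing in one digit. The Fibonacci cube $\mathcal{F}_r$ is the subgraph of $Q_r$ induced by the binary strings $a_1\cdots a_r$ with $a_ia_{i+1}=0$ for all $1\le i\le r-1$ (no two consecutive 1s). -}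

module Defs where

open import Data.Nat using (ℕ; zero; suc; _+_; _*_; _≤_)
open import Data.Fin using (Fin)
open import Data.Bool using (Bool; true; false; _∧_; not; T)
open import Data.Maybe using (Maybe; just; nothing)
open import Data.List using (List; []; _∷_; _++_; length; drop; concat; replicate)
open import Data.List.Relation.Unary.Unique.Propositional using (Unique)
open import Data.List.Membership.Propositional using (_∈_)
open import Data.Vec using (Vec; []; _∷_)
open import Data.Product using (Σ; ∃; _×_; _,_)
open import Data.Sum using (_⊎_)
open import Data.Empty using (⊥)
open import Relation.Nullary using (¬_)
open import Relation.Binary.PropositionalEquality using (_≡_; _≢_)
open import Relation.Binary.Construct.Closure.ReflexiveTransitive using (Star)
open import Function.Bundles using (_⇔_)

-- Coxeter matrices on a finite generating set S = Fin n.
-- m s t : Maybe ℕ, where `nothing` encodes m(s,t) = ∞.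

record CoxeterMatrix (n : ℕ) : Set where
  field
    m    : Fin n → Fin n → Maybe ℕ
    sym  : ∀ s t → m s t ≡ m t s
    diag : ∀ s → m s s ≡ just 1
    off  : ∀ s t → s ≢ t → m s t ≡ nothing ⊎ Σ ℕ (λ k → m s t ≡ just k × 2 ≤ k)

module _ {n : ℕ} (M : CoxeterMatrix n) where
  open CoxeterMatrix M using (m)

  Word : Set
  Word = List (Fin n)

  pw : Fin n → Fin n → ℕ → Word
  pw s t k = concat (replicate k (s ∷ t ∷ []))

  -- equality in W = ⟨S | (st)^{m(s,t)} = e⟩ : the congruence on words
  -- generated by the defining relations (s^2 = e makes every s its own inverse,
  -- so W is the monoid with this presentation)
  data _≈W_ : Word → Word → Set where
    rel   : ∀ s t k → m s t ≡ just k → ∀ pre post →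
            (pre ++ pw s t k ++ post) ≈W (pre ++ post)
    W-refl  : ∀ {α} → α ≈W α
    W-sym   : ∀ {α β} → α ≈W β → β ≈W α
    W-trans : ∀ {α β γ} → α ≈W β → β ≈W γ → α ≈W γ

  Reduced : Word → Set
  Reduced α = ∀ β → β ≈W α → length α ≤ length β

  SimplyLaced : Set
  SimplyLaced = ∀ s t → Σ ℕ (λ k → m s t ≡ just k × k ≤ 3)

  Edge : Fin n → Fin n → Set
  Edge s t = s ≢ t × (m s t ≡ nothing ⊎ Σ ℕ (λ k → m s t ≡ just k × 3 ≤ k))

  TriangleFree : Set
  TriangleFree = ∀ s t u → ¬ (Edge s t × Edge t u × Edge s u)

  BraidStep : Word → Word → Set
  BraidStep α β = Σ Word λ pre → Σ Word λ post → Σ (Fin n) λ s → Σ (Fin n) λ t →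
    m s t ≡ just 3 × α ≡ pre ++ (s ∷ t ∷ s ∷ post) × β ≡ pre ++ (t ∷ s ∷ t ∷ post)

  InClass : Word → Word → Set
  InClass α β = Star BraidStep α β

  -- braid shadow ⟦i, i+2⟧ with i 1-indexed
  ShadowHere : Word → Set
  ShadowHere (s ∷ t ∷ u ∷ _) = s ≡ u × m s t ≡ just 3
  ShadowHere _ = ⊥

  IsShadow : Word → ℕ → Set
  IsShadow α zero    = ⊥
  IsShadow α (suc j) = ShadowHere (drop j α)

  InBsClass : Word → ℕ → Set
  InBsClass α i = Σ Word λ β → InClass α β × IsShadow β i

  HasRank : Word → ℕ → Set
  HasRank α r = Σ (List ℕ) λ L → Unique L × length L ≡ r × (∀ i → (i ∈ L) ⇔ InBsClass α i)

  Odd : ℕ → Set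
  Odd i = Σ ℕ λ k → i ≡ suc (2 * k)

  IsLink : Word → Set
  IsLink α = Reduced α ×
    (length α ≡ 1 ⊎
      (Odd (length α) × (∀ i → InBsClass α i ⇔ (Odd i × i + 2 ≤ length α))))

  IsFibonacciLink : Word → Set
  IsFibonacciLink φ = IsLink φ × (∀ i → InBsClass φ i ⇔ IsShadow φ i)

noConsec : ∀ {r} → Vec Bool r → Bool
noConsec [] = true
noConsec (a ∷ []) = true
noConsec (a ∷ b ∷ v) = not (a ∧ b) ∧ noConsec (b ∷ v)

FibVertex : ℕ → Set
FibVertex r = Σ (Vec Bool r) λ v → T (noConsec v)

hamming : ∀ {r} → Vec Bool r → Vec Bool r → ℕ
hamming [] [] = 0
hamming (true ∷ v) (true ∷ w) = hamming v w
hamming (false ∷ v) (false ∷ w) = hamming v w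
hamming (_ ∷ v) (_ ∷ w) = suc (hamming v w)

FibAdj : ∀ {r} → FibVertex r → FibVertex r → Set
FibAdj (v , _) (w , _) = hamming v w ≡ 1

record FibIsoBraidGraph {n : ℕ} (M : CoxeterMatrix n) (φ : Word M) (r : ℕ) : Set where
  field
    g    : FibVertex r → Word M
    into : ∀ x → InClass M φ (g x)
    inj  : ∀ x y → g x ≡ g y → Data.Product.proj₁ x ≡ Data.Product.proj₁ y
    surj : ∀ β → InClass M φ β → Σ (FibVertex r) λ x → g x ≡ β
    adj  : ∀ x y → BraidStep M (g x) (g y) ⇔ FibAdj x y

-- The braid shadows of a Fibonacci link φ all lie in φ itself, at the odd positions,
-- so φ = s t₁ s t₂ s ⋯ tᵣ s with m(s,tᵢ) = 3.  Encode a binary string v of length r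
-- by the word obtained from φ by replacing the i-th block s tᵢ s with tᵢ s tᵢ wherever
-- vᵢ = 1; two such blocks overlap exactly when two consecutive bits are 1, so Fibonacci
-- strings give words in [φ], and flipping one bit is one braid move.  Conversely, a
-- braid move at an odd position of an encoded word either flips one bit, or acts on
-- a factor tᵢ tᵢ₊₁ tᵢ₊₂ with tᵢ = tᵢ₊₂ (blocks i and i+2 flipped), which would make
-- s, tᵢ, tᵢ₊₁ a triangle in the Coxeter graph.  Since shadows of [φ] sit at odd positions,
-- [φ] is exactly the set of encoded words, and the rank of φ is r.
module Submission where

open import Defs
open import Data.Nat using (ℕ; zero; suc; _+_; _*_; _≤_; _<_; z≤n; s≤s; s≤s⁻¹)
open import Data.Nat.Properties using (suc-injective; 0≢1+n; +-comm; *-suc; *-cancelˡ-≡; *-cancelˡ-≤; *-monoʳ-≤; <⇒≢)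
open import Data.Fin using (Fin)
open import Data.Bool using (Bool; true; false; T)
open import Data.Maybe using (just)
open import Data.List using (List; []; _∷_; _++_; length; applyUpTo)
open import Data.List.Properties using (∷-injectiveˡ; ++-assoc; length-applyUpTo)
open import Data.List.Membership.Propositional using (_∈_)
open import Data.List.Membership.Propositional.Properties using (∈-applyUpTo⁺; ∈-applyUpTo⁻)
open import Data.List.Membership.Propositional.Properties.WithK using (unique∧set⇒bag)
open import Data.List.Relation.Unary.Unique.Propositional using (Unique)
open import Data.List.Relation.Unary.Unique.Propositional.Properties using (applyUpTo⁺₁)
open import Data.List.Relation.Binary.BagAndSetEquality using (∼bag⇒↭)
open import Data.List.Relation.Binary.Permutation.Propositional.Properties using (↭-length)
open import Data.Vec using (Vec; []; _∷_; replicate)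
open import Data.Vec.Relation.Unary.All using (All; []; _∷_)
open import Data.Product using (Σ; _×_; _,_; proj₁; proj₂)
open import Data.Sum using (inj₁; inj₂)
open import Data.Empty using (⊥-elim)
open import Data.Unit using (tt)
open import Relation.Nullary using (¬_)
open import Relation.Binary.PropositionalEquality
open import Relation.Binary.Construct.Closure.ReflexiveTransitive using (ε; _◅_; _◅◅_; gmap)
open import Function.Bundles using (_⇔_; mk⇔; Equivalence)
open import Function.Properties.Equivalence using () renaming (trans to ⇔-trans; sym to ⇔-sym)

data Even : ℕ → Set where
  even-zero : Even 0
  even-suc  : ∀ {k} → Even k → Even (suc (suc k))

even-2* : ∀ j → Even (2 * j)
even-2* zero    = even-zero
even-2* (suc j) = subst Even (sym (*-suc 2 j)) (even-suc (even-2* j))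

odd+2≤odd⇔< : ∀ j k → suc (2 * j) + 2 ≤ suc (2 * k) ⇔ j < k
odd+2≤odd⇔< j k = mk⇔
  (λ le → *-cancelˡ-≤ 2 (s≤s⁻¹ (subst (_≤ suc (2 * k)) lhs≡ le)))
  (λ lt → subst (_≤ suc (2 * k)) (sym lhs≡) (s≤s (*-monoʳ-≤ 2 lt)))
  where
  lhs≡ : suc (2 * j) + 2 ≡ suc (2 * suc j)
  lhs≡ = cong suc (trans (+-comm (2 * j) 2) (sym (*-suc 2 j)))

odds : ℕ → List ℕ
odds = applyUpTo (λ j → suc (2 * j))

odds-unique : ∀ k → Unique (odds k)
odds-unique k = applyUpTo⁺₁ _ k λ i<j _ eq → <⇒≢ i<j (*-cancelˡ-≡ _ _ 2 (suc-injective eq))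

odd∧bounded⇔∈odds : ∀ {k ℓ} i → ℓ ≡ suc (2 * k) →
                    (Σ ℕ (λ j → i ≡ suc (2 * j)) × i + 2 ≤ ℓ) ⇔ i ∈ odds k
odd∧bounded⇔∈odds {k} i refl = mk⇔
  (λ { ((j , refl) , le) → ∈-applyUpTo⁺ _ (Equivalence.to (odd+2≤odd⇔< j k) le) })
  (λ p → let (j , j<k , i≡) = ∈-applyUpTo⁻ _ p in
    (j , i≡) , subst (λ i → i + 2 ≤ suc (2 * k)) (sym i≡) (Equivalence.from (odd+2≤odd⇔< j k) j<k))

unique-same-members⇒length≡ : ∀ {A : Set} {xs ys : List A} → Unique xs → Unique ys →
                              (∀ {z} → z ∈ xs ⇔ z ∈ ys) → length xs ≡ length ys
unique-same-members⇒length≡ uxs uys same = ↭-length (∼bag⇒↭ (unique∧set⇒bag uxs uys same))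

∷∷-injective : ∀ {A : Set} {a b c d : A} {xs ys : List A} →
               _≡_ {A = List A} (a ∷ b ∷ xs) (c ∷ d ∷ ys) → a ≡ c × b ≡ d × xs ≡ ys
∷∷-injective refl = refl , refl , refl

letter-not-braidable : ∀ {A : Set} (pre : List A) {a x y : A} {post : List A} →
                       _≢_ {A = List A} (a ∷ []) (pre ++ x ∷ y ∷ x ∷ post)
letter-not-braidable []            ()
letter-not-braidable (_ ∷ [])      ()
letter-not-braidable (_ ∷ _ ∷ _)   ()

noConsec-tail : ∀ {r} b (v : Vec Bool r) → T (noConsec (b ∷ v)) → T (noConsec v)
noConsec-tail b     []          _  = tt
noConsec-tail false (_ ∷ v)     nc = nc
noConsec-tail true  (false ∷ v) nc = nc

noConsec-false∷ : ∀ {r} (v : Vec Bool r) → T (noConsec v) → T (noConsec (false ∷ v))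
noConsec-false∷ []      _  = tt
noConsec-false∷ (_ ∷ v) nc = nc

noConsec-replicate-false : ∀ r → T (noConsec (replicate r false))
noConsec-replicate-false zero    = tt
noConsec-replicate-false (suc r) = noConsec-false∷ (replicate r false) (noConsec-replicate-false r)

hamming-refl : ∀ {r} (v : Vec Bool r) → hamming v v ≡ 0
hamming-refl []          = refl
hamming-refl (true ∷ v)  = hamming-refl v
hamming-refl (false ∷ v) = hamming-refl v

hamming≡0⇒≡ : ∀ {r} (v w : Vec Bool r) → hamming v w ≡ 0 → v ≡ w
hamming≡0⇒≡ []          []          _ = refl
hamming≡0⇒≡ (true ∷ v)  (true ∷ w)  h = cong (true ∷_) (hamming≡0⇒≡ v w h)
hamming≡0⇒≡ (false ∷ v) (false ∷ w) h = cong (false ∷_) (hamming≡0⇒≡ v w h)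

module _ {n : ℕ} (M : CoxeterMatrix n) where
  open CoxeterMatrix M using (m; diag) renaming (sym to m-sym)

  Braids : Fin n → Fin n → Set
  Braids a b = m a b ≡ just 3

  braids-irrefl : ∀ {a b} → Braids a b → a ≢ b
  braids-irrefl {a} ab refl with () ← trans (sym (diag a)) ab

  braids-sym : ∀ {a b} → Braids a b → Braids b a
  braids-sym {a} {b} ab = trans (m-sym b a) ab

  braids⇒edge : ∀ {a b} → Braids a b → Edge M a b
  braids⇒edge ab = braids-irrefl ab , inj₂ (3 , ab , s≤s (s≤s (s≤s z≤n)))

  braidStep-++ˡ : ∀ p {α β} → BraidStep M α β → BraidStep M (p ++ α) (p ++ β)
  braidStep-++ˡ p (pre , post , a , b , ab , refl , refl) =
    p ++ pre , post , a , b , ab , sym (++-assoc p pre _) , sym (++-assoc p pre _)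

  inClass-++ˡ : ∀ p {α β} → InClass M α β → InClass M (p ++ α) (p ++ β)
  inClass-++ˡ p = gmap (p ++_) (braidStep-++ˡ p)

  isShadow-braidable : ∀ pre {x y post} → Braids x y → IsShadow M (pre ++ x ∷ y ∷ x ∷ post) (suc (length pre))
  isShadow-braidable []        xy = refl , xy
  isShadow-braidable (_ ∷ pre) xy = isShadow-braidable pre xy

  letter-has-no-shadows : ∀ {a} i → ¬ InBsClass M (a ∷ []) i
  letter-has-no-shadows (suc zero)          (_ , ε , ())
  letter-has-no-shadows (suc (suc zero))    (_ , ε , ())
  letter-has-no-shadows (suc (suc (suc _))) (_ , ε , ())
  letter-has-no-shadows i (_ , (pre , _ , _ , _ , _ , eq , _) ◅ _ , _) = letter-not-braidable pre eq

  link-shadows : ∀ {φ} → IsLink M φ →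
                 Σ ℕ λ k → length φ ≡ suc (2 * k) × (∀ i → InBsClass M φ i ⇔ i ∈ odds k)
  link-shadows (_ , inj₂ ((k , len) , bs)) =
    k , len , λ i → ⇔-trans (bs i) (odd∧bounded⇔∈odds i len)
  link-shadows {_ ∷ []}    (_ , inj₁ _) = 0 , refl , λ i → mk⇔ (λ sh → ⊥-elim (letter-has-no-shadows i sh)) λ ()
  link-shadows {[]}        (_ , inj₁ ())
  link-shadows {_ ∷ _ ∷ _} (_ , inj₁ ())

  module FibonacciWords (s : Fin n) where

    -- Adjacent true bits (which no Fibonacci string has) give the junk value [].
    fibWord : ∀ {r} → Vec (Fin n) r → Vec Bool r → Word M
    fibWord []            []                  = s ∷ []
    fibWord (t ∷ ts)      (false ∷ v)         = s ∷ t ∷ fibWord ts v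
    fibWord (t ∷ [])      (true ∷ [])         = t ∷ s ∷ t ∷ []
    fibWord (t ∷ t′ ∷ ts) (true ∷ false ∷ v)  = t ∷ s ∷ t ∷ t′ ∷ fibWord ts v
    fibWord (t ∷ t′ ∷ ts) (true ∷ true ∷ v)   = []

    fibWord-injective : ∀ {r} {ts : Vec (Fin n) r} → All (Braids s) ts →
                        ∀ v w → T (noConsec v) → T (noConsec w) → fibWord ts v ≡ fibWord ts w → v ≡ w
    fibWord-injective [] [] [] _ _ _ = refl
    fibWord-injective (_ ∷ st) (false ∷ v) (false ∷ w) ncv ncw eq
      with _ , _ , eq′ ← ∷∷-injective eq =
      cong (false ∷_) (fibWord-injective st v w (noConsec-tail false v ncv) (noConsec-tail false w ncw) eq′)
    fibWord-injective {ts = _ ∷ []} (st ∷ _) (false ∷ []) (true ∷ []) _ _ eq =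
      ⊥-elim (braids-irrefl st (∷-injectiveˡ eq))
    fibWord-injective {ts = _ ∷ _ ∷ _} (st ∷ _) (false ∷ v) (true ∷ false ∷ w) _ _ eq =
      ⊥-elim (braids-irrefl st (∷-injectiveˡ eq))
    fibWord-injective {ts = _ ∷ []} (st ∷ _) (true ∷ []) (false ∷ []) _ _ eq =
      ⊥-elim (braids-irrefl st (sym (∷-injectiveˡ eq)))
    fibWord-injective {ts = _ ∷ _ ∷ _} (st ∷ _) (true ∷ false ∷ v) (false ∷ w) _ _ eq =
      ⊥-elim (braids-irrefl st (sym (∷-injectiveˡ eq)))
    fibWord-injective {ts = _ ∷ []} _ (true ∷ []) (true ∷ []) _ _ _ = refl
    fibWord-injective (_ ∷ _ ∷ st) (true ∷ false ∷ v) (true ∷ false ∷ w) ncv ncw eq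
      with _ , _ , eq′ ← ∷∷-injective eq
      with _ , _ , eq″ ← ∷∷-injective eq′ =
      cong (λ u → true ∷ false ∷ u)
        (fibWord-injective st v w (noConsec-tail false v ncv) (noConsec-tail false w ncw) eq″)
    fibWord-injective {ts = _ ∷ _ ∷ _} _ (true ∷ true ∷ v) _ () _ _
    fibWord-injective {ts = _ ∷ _ ∷ _} _ _ (true ∷ true ∷ w) _ () _

    hamming≡1⇒braidStep : ∀ {r} {ts : Vec (Fin n) r} → All (Braids s) ts →
                          ∀ v w → T (noConsec v) → T (noConsec w) → hamming v w ≡ 1 →
                          BraidStep M (fibWord ts v) (fibWord ts w)
    hamming≡1⇒braidStep [] [] [] _ _ ()
    hamming≡1⇒braidStep {ts = t ∷ _} (_ ∷ st) (false ∷ v) (false ∷ w) ncv ncw h =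
      braidStep-++ˡ (s ∷ t ∷ [])
        (hamming≡1⇒braidStep st v w (noConsec-tail false v ncv) (noConsec-tail false w ncw) h)
    hamming≡1⇒braidStep {ts = t ∷ []} (st ∷ _) (false ∷ []) (true ∷ []) _ _ _ =
      [] , [] , s , t , st , refl , refl
    hamming≡1⇒braidStep {ts = t ∷ t′ ∷ ts} (st ∷ _) (false ∷ false ∷ v) (true ∷ false ∷ w) _ _ h
      rewrite hamming≡0⇒≡ v w (suc-injective h) =
      [] , t′ ∷ fibWord ts w , s , t , st , refl , refl
    hamming≡1⇒braidStep {ts = t ∷ []} (st ∷ _) (true ∷ []) (false ∷ []) _ _ _ =
      [] , [] , t , s , braids-sym st , refl , refl
    hamming≡1⇒braidStep {ts = t ∷ t′ ∷ ts} (st ∷ _) (true ∷ false ∷ v) (false ∷ false ∷ w) _ _ h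
      rewrite hamming≡0⇒≡ v w (suc-injective h) =
      [] , t′ ∷ fibWord ts w , t , s , braids-sym st , refl , refl
    hamming≡1⇒braidStep {ts = t ∷ t′ ∷ _} (_ ∷ _ ∷ st) (true ∷ false ∷ v) (true ∷ false ∷ w) ncv ncw h =
      braidStep-++ˡ (t ∷ s ∷ t ∷ t′ ∷ [])
        (hamming≡1⇒braidStep st v w (noConsec-tail false v ncv) (noConsec-tail false w ncw) h)
    hamming≡1⇒braidStep {ts = _ ∷ []} _ (true ∷ []) (true ∷ []) _ _ ()
    hamming≡1⇒braidStep {ts = _ ∷ _ ∷ _} _ (false ∷ true ∷ v) (true ∷ false ∷ w) _ _ ()
    hamming≡1⇒braidStep {ts = _ ∷ _ ∷ _} _ (true ∷ false ∷ v) (false ∷ true ∷ w) _ _ ()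
    hamming≡1⇒braidStep {ts = _ ∷ _ ∷ _} _ (true ∷ true ∷ v) _ () _ _
    hamming≡1⇒braidStep {ts = _ ∷ _ ∷ _} _ _ (true ∷ true ∷ w) _ () _

    fibWord-reachable : ∀ {r} {ts : Vec (Fin n) r} → All (Braids s) ts → ∀ v → T (noConsec v) →
                        InClass M (fibWord ts (replicate r false)) (fibWord ts v)
    fibWord-reachable [] [] _ = ε
    fibWord-reachable {ts = t ∷ _} (_ ∷ st) (false ∷ v) nc =
      inClass-++ˡ (s ∷ t ∷ []) (fibWord-reachable st v (noConsec-tail false v nc))
    fibWord-reachable {ts = t ∷ []} (st ∷ _) (true ∷ []) _ = ([] , [] , s , t , st , refl , refl) ◅ ε
    fibWord-reachable {ts = t ∷ t′ ∷ ts} (st ∷ _ ∷ st′) (true ∷ false ∷ v) nc =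
      inClass-++ˡ (s ∷ t ∷ s ∷ t′ ∷ []) (fibWord-reachable st′ v (noConsec-tail false v nc))
      ◅◅ (([] , t′ ∷ fibWord ts v , s , t , st , refl , refl) ◅ ε)
    fibWord-reachable {ts = _ ∷ _ ∷ _} _ (true ∷ true ∷ v) ()

    FibNeighbour : ∀ {r} → Vec (Fin n) r → Vec Bool r → Word M → Set
    FibNeighbour {r} ts v β = Σ (Vec Bool r) λ w → T (noConsec w) × β ≡ fibWord ts w × hamming v w ≡ 1

    braidStep-at-front : ∀ {r} {ts : Vec (Fin n) r} → All (Braids s) ts → ∀ v → T (noConsec v) →
                         ∀ {x y post} → fibWord ts v ≡ x ∷ y ∷ x ∷ post → FibNeighbour ts v (y ∷ x ∷ y ∷ post)
    braidStep-at-front [] [] _ ()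
    braidStep-at-front {ts = _ ∷ []} _ (false ∷ []) _ refl = true ∷ [] , tt , refl , refl
    braidStep-at-front {ts = _ ∷ _ ∷ _} _ (false ∷ false ∷ v) nc refl =
      true ∷ false ∷ v , nc , refl , cong suc (hamming-refl v)
    braidStep-at-front {ts = _ ∷ _ ∷ []} (_ ∷ st′ ∷ _) (false ∷ true ∷ []) _ eq
      with refl , _ , eq′ ← ∷∷-injective eq = ⊥-elim (braids-irrefl st′ (sym (∷-injectiveˡ eq′)))
    braidStep-at-front {ts = _ ∷ _ ∷ _ ∷ _} (_ ∷ st′ ∷ _) (false ∷ true ∷ false ∷ v) _ eq
      with refl , _ , eq′ ← ∷∷-injective eq = ⊥-elim (braids-irrefl st′ (sym (∷-injectiveˡ eq′)))
    braidStep-at-front {ts = _ ∷ _ ∷ _ ∷ _} _ (false ∷ true ∷ true ∷ v) () _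
    braidStep-at-front {ts = _ ∷ []} _ (true ∷ []) _ refl = false ∷ [] , tt , refl , refl
    braidStep-at-front {ts = _ ∷ _ ∷ _} _ (true ∷ false ∷ v) nc refl =
      false ∷ false ∷ v , nc , refl , cong suc (hamming-refl v)
    braidStep-at-front {ts = _ ∷ _ ∷ _} _ (true ∷ true ∷ v) () _

    braidStep-at-even : TriangleFree M → ∀ {r} {ts : Vec (Fin n) r} → All (Braids s) ts →
                        ∀ v → T (noConsec v) → ∀ pre {x y post} → Even (length pre) → Braids x y →
                        fibWord ts v ≡ pre ++ x ∷ y ∷ x ∷ post → FibNeighbour ts v (pre ++ y ∷ x ∷ y ∷ post)
    braidStep-at-even tf st v nc [] even-zero xy eq = braidStep-at-front st v nc eq
    braidStep-at-even tf [] [] _ (_ ∷ _ ∷ pre) (even-suc ev) xy ()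
    braidStep-at-even tf {ts = t ∷ _} (_ ∷ st) (false ∷ v) nc (_ ∷ _ ∷ pre) (even-suc ev) xy eq
      with refl , refl , eq′ ← ∷∷-injective eq
      with w , ncw , β≡ , h ← braidStep-at-even tf st v (noConsec-tail false v nc) pre ev xy eq′ =
      false ∷ w , noConsec-false∷ w ncw , cong (λ u → s ∷ t ∷ u) β≡ , h
    braidStep-at-even tf {ts = _ ∷ []} _ (true ∷ []) _ (_ ∷ _ ∷ pre) (even-suc ev) xy eq
      with refl , refl , eq′ ← ∷∷-injective eq = ⊥-elim (letter-not-braidable pre eq′)
    braidStep-at-even tf {ts = _ ∷ _ ∷ _} (st ∷ st′ ∷ _) (true ∷ false ∷ v) _ (_ ∷ _ ∷ []) _ xy eq
      with refl , refl , eq′ ← ∷∷-injective eq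
      with refl , refl , _ ← ∷∷-injective eq′ =
      ⊥-elim (tf _ _ _ (braids⇒edge st , braids⇒edge xy , braids⇒edge st′))
    braidStep-at-even tf {ts = t ∷ t′ ∷ _} (_ ∷ _ ∷ st) (true ∷ false ∷ v) nc (_ ∷ _ ∷ _ ∷ _ ∷ pre) (even-suc (even-suc ev)) xy eq
      with refl , refl , eq′ ← ∷∷-injective eq
      with refl , refl , eq″ ← ∷∷-injective eq′
      with w , ncw , β≡ , h ← braidStep-at-even tf st v (noConsec-tail false v nc) pre ev xy eq″ =
      true ∷ false ∷ w , noConsec-false∷ w ncw , cong (λ u → t ∷ s ∷ t ∷ t′ ∷ u) β≡ , h
    braidStep-at-even tf {ts = _ ∷ _ ∷ _} _ (true ∷ true ∷ v) () _ _

    module _ (tf : TriangleFree M) {r} {ts : Vec (Fin n) r} (st : All (Braids s) ts)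
             (shadows-odd : ∀ i → InBsClass M (fibWord ts (replicate r false)) i → Odd M i) where

      braidStep-in-class : ∀ {v β} → T (noConsec v) → InClass M (fibWord ts (replicate r false)) (fibWord ts v) →
                           BraidStep M (fibWord ts v) β → FibNeighbour ts v β
      braidStep-in-class {v} nc cls (pre , _ , _ , _ , xy , eq , refl) =
        braidStep-at-even tf st v nc pre pre-even xy eq
        where
        pre-even : Even (length pre)
        pre-even with j , i≡ ← shadows-odd (suc (length pre))
                     (_ , cls , subst (λ α → IsShadow M α (suc (length pre))) (sym eq) (isShadow-braidable pre xy))
          = subst Even (sym (suc-injective i≡)) (even-2* j)

      class⊆fibWords : ∀ {α β} → InClass M (fibWord ts (replicate r false)) α → InClass M α β →
                       ∀ v → T (noConsec v) → α ≡ fibWord ts v → Σ (FibVertex r) λ x → fibWord ts (proj₁ x) ≡ β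
      class⊆fibWords _   ε              v nc refl = (v , nc) , refl
      class⊆fibWords cls (step ◅ steps) v nc refl
        with w , ncw , β≡ , _ ← braidStep-in-class nc cls step =
        class⊆fibWords (cls ◅◅ (step ◅ ε)) steps w ncw β≡

      fibWord-iso : FibIsoBraidGraph M (fibWord ts (replicate r false)) r
      fibWord-iso = record
        { g    = λ x → fibWord ts (proj₁ x)
        ; into = λ (v , nc) → fibWord-reachable st v nc
        ; inj  = λ (v , ncv) (w , ncw) → fibWord-injective st v w ncv ncw
        ; surj = λ β cls → class⊆fibWords ε cls (replicate r false) (noConsec-replicate-false r) refl
        ; adj  = λ (v , ncv) (w , ncw) → mk⇔ (braidStep⇒hamming≡1 ncv ncw) (hamming≡1⇒braidStep st v w ncv ncw)
        }
        where
        braidStep⇒hamming≡1 : ∀ {v w} → T (noConsec v) → T (noConsec w) →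
                              BraidStep M (fibWord ts v) (fibWord ts w) → hamming v w ≡ 1
        braidStep⇒hamming≡1 {v} {w} ncv ncw step
          with w′ , ncw′ , eq , h ← braidStep-in-class ncv (fibWord-reachable st v ncv) step
          rewrite fibWord-injective st w w′ ncw ncw′ eq = h

  open FibonacciWords public

  spine-decomposition : ∀ k s w → length w ≡ 2 * k → (∀ j → j < k → IsShadow M (s ∷ w) (suc (2 * j))) →
                        Σ (Vec (Fin n) k) λ ts → All (Braids s) ts × s ∷ w ≡ fibWord s ts (replicate k false)
  spine-decomposition zero    s []           _   _  = [] , [] , refl
  spine-decomposition (suc k) s (_ ∷ [])     len _  = ⊥-elim (0≢1+n (suc-injective (trans len (*-suc 2 k))))
  spine-decomposition (suc k) s (t ∷ u ∷ w) len sh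
    with refl , st ← sh 0 (s≤s z≤n)
    with ts , sts , w≡ ← spine-decomposition k s w (suc-injective (suc-injective (trans len (*-suc 2 k))))
                           (λ j j<k → subst (λ i → IsShadow M (s ∷ t ∷ s ∷ w) (suc i)) (*-suc 2 j) (sh (suc j) (s≤s j<k)))
    = t ∷ ts , st ∷ sts , cong (λ z → s ∷ t ∷ z) w≡

  fibonacciLink-spine : ∀ {φ k} → IsFibonacciLink M φ → length φ ≡ suc (2 * k) →
                        (∀ i → InBsClass M φ i ⇔ i ∈ odds k) →
                        Σ (Fin n) λ s → Σ (Vec (Fin n) k) λ ts → All (Braids s) ts × φ ≡ fibWord s ts (replicate k false)
  fibonacciLink-spine {s ∷ w} {k} (_ , shadows-in-φ) len shadows
    with ts , st , φ≡ ← spine-decomposition k s w (suc-injective len) (λ j j<k →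
           Equivalence.to (shadows-in-φ (suc (2 * j))) (Equivalence.from (shadows _) (∈-applyUpTo⁺ _ j<k)))
    = s , ts , st , φ≡

theorem6p10 : ∀ {n : ℕ} (M : CoxeterMatrix n) → SimplyLaced M → TriangleFree M →
              (φ : List (Fin n)) (r : ℕ) → IsFibonacciLink M φ → HasRank M φ r →
              FibIsoBraidGraph M φ r
theorem6p10 M _ tf φ r fib (L , L-unique , L-length , L-members)
  with k , length≡ , shadows ← link-shadows M (proj₁ fib)
  with s , ts , st , refl ← fibonacciLink-spine M fib length≡ shadows
  = subst (FibIsoBraidGraph M _) k≡r (fibWord-iso M s tf st shadows-odd)
  where
  shadows-odd : ∀ i → InBsClass M (fibWord M s ts (replicate k false)) i → Odd M i
  shadows-odd i sh with j , _ , i≡ ← ∈-applyUpTo⁻ _ (Equivalence.to (shadows i) sh) = j , i≡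

  k≡r : k ≡ r
  k≡r = begin
    k                ≡⟨ length-applyUpTo _ k ⟨
    length (odds k)  ≡⟨ unique-same-members⇒length≡ (odds-unique k) L-unique
                          (λ {i} → ⇔-trans (⇔-sym (shadows i)) (⇔-sym (L-members i))) ⟩
    length L         ≡⟨ L-length ⟩
    r                ∎
    where open ≡-Reasoning
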